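{- Let $n,m\ge 1$ be integers and $p\in[0,1]$. Let $G^*(n,m,p)$ be the random bipartite graph with disjoint vertex sets $V$ ($|V|=n$) and $W$ ($|W|=m$), in which each pair $\{v,w\}$ with $v\in V$, $w\in W$ is an edge independently with probability $p$, and there are no edges inside $V$ or inside $W$. Let $G^{active}(n,m,p)$ be the graph on vertex set $V$ in which distinct $v_1,v_2\in V$ are adjacent if and only if there is some $w\in W$ adjacent in $G^*(n,m,p)$ to both $v_1$ and $v_2$; and let $G^{passive}(n,m,p)$ be the graph on vertex set $W$ in which distinct $w_1,w_2\in W$ are adjacent if and only if there is some $v\in V$ adjacent in $G^*(n,m,p)$ to both $w_1$ and $w_2$. Fix $v\in V$ and $w\in W$, let $X$ be the number of vertices of $V\setminus\{v\}$ adjacent to $v$ in $G^{active}(n,m,p)$, and let $Y$ be the number of vertices of $W\setminus\{w\}$ adjacent to $w$ in $G^{passive}(n,m,p)$. Then for all $x,y\in\mathbb{R}$, the joint probability generating function $F(x,y):=\mathbb{E}\,x^Xy^Y$ is given by \begin{eqnarray*} F(x,y)&=&\sum_{k=0}^{n-1}\sum_{l=0}^{m-1}{n-1 \choose k}{m-1\choose l}x^{n-1-k}(1-x)^ky^{m-1-l}(1-y)^l\\ & &\cdot \big[1-p+p(1-p)^k\big]^{m-1-l}\big[1-p+p(1-p)^l\big]^{n-1-k}\\ & &\cdot \Big[(1-p)^{k+l}p+(1-p)\sum_{i=0}^l{l\choose i}p^{i}(1-p)^{l-i}\big[(1-p)^{i+1}+p(1-p)^l\big]^k\Big]. \end{e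qnarray*}
   Context: Convention: $0^0=1$. -}

module Defs where

open import Level using (Level)
open import Data.Bool using (Bool; true; false; if_then_else_; _∧_; not)
open import Data.Nat using (ℕ; zero; suc; _∸_)
open import Data.Nat.Combinatorics using (_C_)
open import Data.Fin using (Fin; zero; suc; _≟_)
open import Data.List using (List; []; _∷_; map; concatMap)
open import Data.Vec.Functional using () renaming (_∷_ to _∷ᶠ_)
open import Relation.Nullary.Decidable using (⌊_⌋)
open import Algebra.Bundles using (CommutativeRing)
import Algebra.Bundles
import Algebra.Definitions.RawSemiring as RSDefs

allFuns : {a : Level} {A : Set a} → (k : ℕ) → List A → List (Fin k → A)
allFuns zero    xs = (λ ()) ∷ []
allFuns (suc k) xs = concatMap (λ a → map (λ f → a ∷ᶠ f) (allFuns k xs)) xs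

BipGraph : ℕ → ℕ → Set
BipGraph n m = Fin n → Fin m → Bool

allBipGraphs : (n m : ℕ) → List (BipGraph n m)
allBipGraphs n m = allFuns n (allFuns m (true ∷ false ∷ []))

anyFin : (k : ℕ) → (Fin k → Bool) → Bool
anyFin zero    P = false
anyFin (suc k) P = P zero Data.Bool.∨ anyFin k (λ i → P (suc i))

countFin : (k : ℕ) → (Fin k → Bool) → ℕ
countFin zero    P = zero
countFin (suc k) P = (if P zero then 1 else 0) Data.Nat.+ countFin k (λ i → P (suc i))

activeAdj : {n m : ℕ} → BipGraph n m → Fin n → Fin n → Bool
activeAdj {n} {m} E v₁ v₂ = not ⌊ v₁ ≟ v₂ ⌋ ∧ anyFin m (λ w → E v₁ w ∧ E v₂ w)

passiveAdj : {n m : ℕ} → BipGraph n m → Fin m → Fin m → Bool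
passiveAdj {n} {m} E w₁ w₂ = not ⌊ w₁ ≟ w₂ ⌋ ∧ anyFin n (λ v → E v w₁ ∧ E v w₂)

degActive : {n m : ℕ} → BipGraph n m → Fin n → ℕ
degActive {n} E v = countFin n (λ u → activeAdj E v u)

degPassive : {n m : ℕ} → BipGraph n m → Fin m → ℕ
degPassive {n} {m} E w = countFin m (λ u → passiveAdj E w u)

module _ {c ℓ : Level} (R : CommutativeRing c ℓ) where
  open CommutativeRing R using (Carrier; _≈_; _+_; _*_; _-_; 0#; 1#; semiring)
  open RSDefs (Algebra.Bundles.Semiring.rawSemiring semiring) using (_^_; _×_)

  sumTo : ℕ → (ℕ → Carrier) → Carrier
  sumTo zero    f = 0#
  sumTo (suc k) f = sumTo k f + f k

  sumList : List Carrier → Carrier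
  sumList []       = 0#
  sumList (a ∷ as) = a + sumList as

  prodFin : (k : ℕ) → (Fin k → Carrier) → Carrier
  prodFin zero    f = 1#
  prodFin (suc k) f = f zero * prodFin k (λ i → f (suc i))

  graphProb : {n m : ℕ} → Carrier → BipGraph n m → Carrier
  graphProb {n} {m} p E =
    prodFin n (λ v → prodFin m (λ w → if E v w then p else (1# - p)))

  jointPGF : (n m : ℕ) → Fin n → Fin m → Carrier → Carrier → Carrier → Carrier
  jointPGF n m v w p x y =
    sumList (map (λ E → graphProb p E * ((x ^ degActive E v) * (y ^ degPassive E w)))
                 (allBipGraphs n m))

  rhsFormula : (n m : ℕ) → Carrier → Carrier → Carrier → Carrier
  rhsFormula n m p x y =
    sumTo n (λ k → sumTo m (λ l →
      ((n ∸ 1) C k) × (((m ∸ 1) C l) ×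
      ((x ^ (n ∸ 1 ∸ k)) * ((1# - x) ^ k) * (y ^ (m ∸ 1 ∸ l)) * ((1# - y) ^ l)
      * ((1# - p + p * ((1# - p) ^ k)) ^ (m ∸ 1 ∸ l))
      * ((1# - p + p * ((1# - p) ^ l)) ^ (n ∸ 1 ∸ k))
      * (((1# - p) ^ (k Data.Nat.+ l)) * p
         + (1# - p) * sumTo (suc l) (λ i →
              (l C i) × ((p ^ i) * ((1# - p) ^ (l ∸ i))
                * (((1# - p) ^ (suc i)) + p * ((1# - p) ^ l)) ^ k)))))))

module Submission where

open import Defs
open import Level using (Level)
open import Function using (_∘_)
open import Data.Bool using (Bool; true; false; if_then_else_; _∧_; _∨_; not)
import Data.Bool.Properties as BoolP
open import Data.Nat as ℕ using (ℕ; zero; suc; _∸_)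
import Data.Nat.Properties as ℕP
open import Data.Nat.Combinatorics using (_C_; nCk+nC[k+1]≡[n+1]C[k+1]; k>n⇒nCk≡0)
open import Data.Fin using (Fin; zero; suc; punchIn; _≟_)
open import Data.Fin.Properties using (punchInᵢ≢i)
open import Data.List using (List; []; _∷_; map; concatMap; _++_)
open import Data.Vec.Functional using (insertAt) renaming (_∷_ to _∷ᶠ_)
open import Data.Vec.Functional.Properties using (∷-cong; insertAt-lookup; insertAt-punchIn)
open import Relation.Nullary.Decidable using (isYes)
open import Relation.Binary.Core using (_Preserves_⟶_)
open import Relation.Binary.PropositionalEquality as ≡ using (_≡_; _≗_; ≡-≟-identity; ≢-≟-identity)
open import Algebra.Bundles using (CommutativeRing)
import Algebra.Bundles
import Algebra.Definitions.RawSemiring as RawSemiringDefs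
import Algebra.Properties.CommutativeSemigroup as CommSemigroupProps

-- Split the graph at the slot vw into the bit e = [vw ∈ E], the edges a from v to W ∖ {w},
-- the edges b from V ∖ {v} to w, and the remaining block M.  A vertex i ≠ v is an active
-- neighbour of v iff (e ∧ b i) or a j ∧ M i j for some j, and symmetrically on W.
-- Expanding x ^ X = ∑_{S ∩ N(v) = ∅} (1 - x) ^ ∣S∣ x ^ (n - ∣S∣) (and likewise y ^ Y) turns
-- F into a sum, over marked sets S ⊆ V ∖ {v} and T ⊆ W ∖ {w}, of the probability that no
-- marked vertex is a neighbour.  This probability factorises: the entries of M are summed
-- out one at a time, then the entries of b, and the remaining sum over a is binomial;
-- the two cases e = 1 and e = 0 give the two summands of the bracket.  It depends only on
-- ∣S∣ and ∣T∣, and grouping by these sizes produces the binomial coefficients.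

bools : List Bool
bools = true ∷ false ∷ []

_≗²_ : {a : Level} {A : Set a} {k l : ℕ} → (Fin k → Fin l → A) → (Fin k → Fin l → A) → Set a
E ≗² E′ = ∀ i → E i ≗ E′ i

insertCorner : {a : Level} {A : Set a} {n m : ℕ} → Fin (suc n) → Fin (suc m) →
  A → (Fin m → A) → (Fin n → A) → (Fin n → Fin m → A) → Fin (suc n) → Fin (suc m) → A
insertCorner v w e a b M = insertAt (λ i → insertAt (M i) w (b i)) v (insertAt a w e)

module ℕ+-Props = CommSemigroupProps ℕP.+-commutativeSemigroup
module ∨-Props = CommSemigroupProps (Algebra.Bundles.CommutativeMonoid.commutativeSemigroup BoolP.∨-commutativeMonoid)

insertAt-pointwise : {a r : Level} {A : Set a} {k : ℕ} (_∼_ : A → A → Set r) {f g : Fin k → A} {z z′ : A} →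
  (∀ i → f i ∼ g i) → z ∼ z′ → ∀ u t → insertAt f u z t ∼ insertAt g u z′ t
insertAt-pointwise _∼_ f∼g z∼z′ zero zero = z∼z′
insertAt-pointwise _∼_ f∼g z∼z′ zero (suc t) = f∼g t
insertAt-pointwise {k = suc k} _∼_ f∼g z∼z′ (suc u) zero = f∼g zero
insertAt-pointwise {k = suc k} _∼_ f∼g z∼z′ (suc u) (suc t) = insertAt-pointwise _∼_ (f∼g ∘ suc) z∼z′ u t

isYes-≟-diag : {k : ℕ} (u : Fin k) → isYes (u ≟ u) ≡ true
isYes-≟-diag u = ≡.cong isYes (≡-≟-identity _≟_ ≡.refl)

isYes-≟-punchIn : {k : ℕ} (u : Fin (suc k)) (i : Fin k) → isYes (u ≟ punchIn u i) ≡ false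
isYes-≟-punchIn u i = ≡.cong isYes (≢-≟-identity _≟_ (punchInᵢ≢i u i ∘ ≡.sym))

countFin-cong : (k : ℕ) {P Q : Fin k → Bool} → P ≗ Q → countFin k P ≡ countFin k Q
countFin-cong zero    P≗Q = ≡.refl
countFin-cong (suc k) P≗Q =
  ≡.cong₂ (λ b r → (if b then 1 else 0) ℕ.+ r) (P≗Q zero) (countFin-cong k (P≗Q ∘ suc))

anyFin-cong : (k : ℕ) {P Q : Fin k → Bool} → P ≗ Q → anyFin k P ≡ anyFin k Q
anyFin-cong zero    P≗Q = ≡.refl
anyFin-cong (suc k) P≗Q = ≡.cong₂ _∨_ (P≗Q zero) (anyFin-cong k (P≗Q ∘ suc))

countFin-punchIn : (k : ℕ) (v : Fin (suc k)) (Q : Fin (suc k) → Bool) →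
  countFin (suc k) Q ≡ (if Q v then 1 else 0) ℕ.+ countFin k (Q ∘ punchIn v)
countFin-punchIn k       zero    Q = ≡.refl
countFin-punchIn (suc k) (suc v) Q = ≡.trans
  (≡.cong ((if Q zero then 1 else 0) ℕ.+_) (countFin-punchIn k v (Q ∘ suc)))
  (ℕ+-Props.x∙yz≈y∙xz (if Q zero then 1 else 0) (if Q (suc v) then 1 else 0) _)

anyFin-punchIn : (k : ℕ) (v : Fin (suc k)) (Q : Fin (suc k) → Bool) →
  anyFin (suc k) Q ≡ Q v ∨ anyFin k (Q ∘ punchIn v)
anyFin-punchIn k       zero    Q = ≡.refl
anyFin-punchIn (suc k) (suc v) Q =
  ≡.trans (≡.cong (Q zero ∨_) (anyFin-punchIn k v (Q ∘ suc))) (∨-Props.x∙yz≈y∙xz (Q zero) (Q (suc v)) _)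

countFin∧ : (k : ℕ) → (Fin k → Bool) → (Fin k → Bool) → ℕ
countFin∧ k T a = countFin k (λ j → T j ∧ a j)

countFin-∧-split : (k : ℕ) (T a : Fin k → Bool) →
  countFin k T ≡ countFin∧ k T a ℕ.+ countFin∧ k T (not ∘ a)
countFin-∧-split zero    T a = ≡.refl
countFin-∧-split (suc k) T a with T zero | a zero
... | true  | true  = ≡.cong suc (countFin-∧-split k (T ∘ suc) (a ∘ suc))
... | true  | false = ≡.trans (≡.cong suc (countFin-∧-split k (T ∘ suc) (a ∘ suc))) (≡.sym (ℕP.+-suc _ _))
... | false | _     = countFin-∧-split k (T ∘ suc) (a ∘ suc)

module FiniteSums {c ℓ : Level} (R : CommutativeRing c ℓ) where
  open CommutativeRing R hiding (zero)
  open RawSemiringDefs (Algebra.Bundles.Semiring.rawSemiring semiring) using (_^_; _×_)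
  open import Relation.Binary.Reasoning.Setoid setoid
  open import Algebra.Properties.CommutativeSemigroup +-commutativeSemigroup as +-Props using ()
  open import Algebra.Properties.CommutativeSemigroup *-commutativeSemigroup as *-Props using ()
  import Algebra.Properties.CommutativeSemiring.Exp commutativeSemiring as Exp
  open import Algebra.Solver.Ring.NaturalCoefficients.Default commutativeSemiring using (solve; _:+_; _:*_; _:=_; con)
  open import Algebra.Properties.CommutativeMonoid.Mult +-commutativeMonoid using (×-congʳ; ×-homo-+; ×-distrib-+)

  private variable
    a b : Level
    A : Set a
    B : Set b

  ∑ : List A → (A → Carrier) → Carrier
  ∑ xs f = sumList R (map f xs)
  syntax ∑ xs (λ z → e) = ∑[ z ∈ xs ] e

  ∑ᶠ : (k : ℕ) → List A → ((Fin k → A) → Carrier) → Carrier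
  ∑ᶠ k xs = ∑ (allFuns k xs)
  syntax ∑ᶠ k xs (λ f → e) = ∑[ f ∶ k ↦ xs ] e

  ∏ : (k : ℕ) → (Fin k → Carrier) → Carrier
  ∏ = prodFin R
  syntax ∏ k (λ i → e) = ∏[ i < k ] e

  ∑< : ℕ → (ℕ → Carrier) → Carrier
  ∑< = sumTo R
  syntax ∑< k (λ i → e) = ∑[ i < k ] e

  ∑-cong : (xs : List A) {f g : A → Carrier} → (∀ z → f z ≈ g z) → ∑ xs f ≈ ∑ xs g
  ∑-cong []       f≈g = refl
  ∑-cong (z ∷ xs) f≈g = +-cong (f≈g z) (∑-cong xs f≈g)

  ∑-zero : (xs : List A) → ∑[ z ∈ xs ] 0# ≈ 0#
  ∑-zero []       = refl
  ∑-zero (z ∷ xs) = trans (+-identityˡ _) (∑-zero xs)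

  ∑-distrib-+ : (xs : List A) (f g : A → Carrier) →
    ∑[ z ∈ xs ] (f z + g z) ≈ ∑ xs f + ∑ xs g
  ∑-distrib-+ []       f g = sym (+-identityˡ 0#)
  ∑-distrib-+ (z ∷ xs) f g = begin
    (f z + g z) + ∑[ z ∈ xs ] (f z + g z) ≈⟨ +-congˡ (∑-distrib-+ xs f g) ⟩
    (f z + g z) + (∑ xs f + ∑ xs g)       ≈⟨ +-Props.interchange _ _ _ _ ⟩
    (f z + ∑ xs f) + (g z + ∑ xs g)       ∎

  *-distribˡ-∑ : (xs : List A) (k : Carrier) (f : A → Carrier) → k * ∑ xs f ≈ ∑[ z ∈ xs ] (k * f z)
  *-distribˡ-∑ []       k f = zeroʳ k
  *-distribˡ-∑ (z ∷ xs) k f = trans (distribˡ _ _ _) (+-congˡ (*-distribˡ-∑ xs k f))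

  *-distribʳ-∑ : (xs : List A) (k : Carrier) (f : A → Carrier) → ∑ xs f * k ≈ ∑[ z ∈ xs ] (f z * k)
  *-distribʳ-∑ []       k f = zeroˡ k
  *-distribʳ-∑ (z ∷ xs) k f = trans (distribʳ _ _ _) (+-congˡ (*-distribʳ-∑ xs k f))

  ∑-comm : (xs : List A) (ys : List B) (f : A → B → Carrier) →
    ∑[ z ∈ xs ] ∑[ y ∈ ys ] f z y ≈ ∑[ y ∈ ys ] ∑[ z ∈ xs ] f z y
  ∑-comm []       ys f = sym (∑-zero ys)
  ∑-comm (z ∷ xs) ys f = trans (+-congˡ (∑-comm xs ys f)) (sym (∑-distrib-+ ys _ _))

  ∑-map : (xs : List A) (g : A → B) (h : B → Carrier) → ∑ (map g xs) h ≈ ∑[ z ∈ xs ] h (g z)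
  ∑-map []       g h = refl
  ∑-map (z ∷ xs) g h = +-congˡ (∑-map xs g h)

  ∑-++ : (xs ys : List A) (h : A → Carrier) → ∑ (xs ++ ys) h ≈ ∑ xs h + ∑ ys h
  ∑-++ []       ys h = sym (+-identityˡ _)
  ∑-++ (z ∷ xs) ys h = trans (+-congˡ (∑-++ xs ys h)) (sym (+-assoc _ _ _))

  ∑-concatMap : (xs : List A) (g : A → List B) (h : B → Carrier) →
    ∑ (concatMap g xs) h ≈ ∑[ z ∈ xs ] ∑ (g z) h
  ∑-concatMap []       g h = refl
  ∑-concatMap (z ∷ xs) g h = trans (∑-++ (g z) (concatMap g xs) h) (+-congˡ (∑-concatMap xs g h))

  ∑ᶠ-suc : (k : ℕ) (xs : List A) (h : (Fin (suc k) → A) → Carrier) →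
    ∑ᶠ (suc k) xs h ≈ ∑[ z ∈ xs ] ∑[ f ∶ k ↦ xs ] h (z ∷ᶠ f)
  ∑ᶠ-suc k xs h = trans (∑-concatMap xs _ h) (∑-cong xs (λ z → ∑-map (allFuns k xs) (z ∷ᶠ_) h))

  ∑ᶠ-insertAt : (k : ℕ) (v : Fin (suc k)) (xs : List A) (h : (Fin (suc k) → A) → Carrier) →
    h Preserves _≗_ ⟶ _≈_ →
    ∑ᶠ (suc k) xs h ≈ ∑[ z ∈ xs ] ∑[ f ∶ k ↦ xs ] h (insertAt f v z)
  ∑ᶠ-insertAt k zero xs h h-cong =
    trans (∑ᶠ-suc k xs h) (∑-cong xs λ z → ∑-cong (allFuns k xs) λ f → h-cong (∷-cong ≡.refl λ _ → ≡.refl))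
  ∑ᶠ-insertAt (suc k) (suc v) xs h h-cong = begin
    ∑ᶠ (suc (suc k)) xs h
      ≈⟨ ∑ᶠ-suc (suc k) xs h ⟩
    ∑[ z ∈ xs ] ∑[ f ∶ suc k ↦ xs ] h (z ∷ᶠ f)
      ≈⟨ ∑-cong xs (λ z → ∑ᶠ-insertAt k v xs (h ∘ (z ∷ᶠ_)) λ f≗g → h-cong (∷-cong ≡.refl f≗g)) ⟩
    ∑[ z ∈ xs ] ∑[ y ∈ xs ] ∑[ f ∶ k ↦ xs ] h (z ∷ᶠ insertAt f v y)
      ≈⟨ ∑-comm xs xs _ ⟩
    ∑[ y ∈ xs ] ∑[ z ∈ xs ] ∑[ f ∶ k ↦ xs ] h (z ∷ᶠ insertAt f v y)
      ≈⟨ ∑-cong xs (λ y → ∑-cong xs λ z → ∑-cong (allFuns k xs) λ f → h-cong (∷-cong ≡.refl λ _ → ≡.refl)) ⟩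
    ∑[ y ∈ xs ] ∑[ z ∈ xs ] ∑[ f ∶ k ↦ xs ] h (insertAt (z ∷ᶠ f) (suc v) y)
      ≈⟨ ∑-cong xs (λ y → sym (∑ᶠ-suc k xs (λ f → h (insertAt f (suc v) y)))) ⟩
    ∑[ y ∈ xs ] ∑[ f ∶ suc k ↦ xs ] h (insertAt f (suc v) y) ∎

  ∑ᶠ-decompose : {r : Level} {X Y Z : Set} (_∼_ : Y → Y → Set r) → (∀ {y} → y ∼ y) →
    (ys : List Y) (xs : List X) (zs : List Z) (g : X → Z → Y) →
    (∀ h → h Preserves _∼_ ⟶ _≈_ → ∑ ys h ≈ ∑[ x ∈ xs ] ∑[ z ∈ zs ] h (g x z)) →
    (n : ℕ) (h : (Fin n → Y) → Carrier) → h Preserves (λ F G → ∀ i → F i ∼ G i) ⟶ _≈_ →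
    ∑ᶠ n ys h ≈ ∑[ b ∶ n ↦ xs ] ∑[ M ∶ n ↦ zs ] h (λ i → g (b i) (M i))
  ∑ᶠ-decompose _∼_ ∼-refl ys xs zs g split zero h h-cong =
    +-congʳ (trans (h-cong λ ()) (sym (+-identityʳ _)))
  ∑ᶠ-decompose {Y = Y} _∼_ ∼-refl ys xs zs g split (suc n) h h-cong = begin
    ∑ᶠ (suc n) ys h
      ≈⟨ ∑ᶠ-suc n ys h ⟩
    ∑[ y ∈ ys ] ∑[ F ∶ n ↦ ys ] h (y ∷ᶠ F)
      ≈⟨ ∑-cong ys (λ y → ∑ᶠ-decompose _∼_ ∼-refl ys xs zs g split n (h ∘ (y ∷ᶠ_))
           λ F∼G → h-cong (∼-∷ ∼-refl F∼G)) ⟩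
    ∑[ y ∈ ys ] rest y
      ≈⟨ split rest (λ y∼y′ → ∑-cong (allFuns n xs) λ b → ∑-cong (allFuns n zs) λ M →
           h-cong (∼-∷ y∼y′ λ _ → ∼-refl)) ⟩
    ∑[ x ∈ xs ] ∑[ z ∈ zs ] rest (g x z)
      ≈⟨ ∑-cong xs (λ x → ∑-comm zs (allFuns n xs) _) ⟩
    ∑[ x ∈ xs ] ∑[ b ∶ n ↦ xs ] ∑[ z ∈ zs ] ∑[ M ∶ n ↦ zs ] h (g x z ∷ᶠ (λ i → g (b i) (M i)))
      ≈⟨ ∑-cong xs (λ x → ∑-cong (allFuns n xs) λ b → sym (trans (∑ᶠ-suc n zs _)
           (∑-cong zs λ z → ∑-cong (allFuns n zs) λ M → h-cong λ { zero → ∼-refl ; (suc i) → ∼-refl }))) ⟩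
    ∑[ x ∈ xs ] ∑[ b ∶ n ↦ xs ] ∑[ M ∶ suc n ↦ zs ] h (λ i → g ((x ∷ᶠ b) i) (M i))
      ≈⟨ sym (∑ᶠ-suc n xs _) ⟩
    ∑[ b ∶ suc n ↦ xs ] ∑[ M ∶ suc n ↦ zs ] h (λ i → g (b i) (M i)) ∎
    where
    rest : Y → Carrier
    rest y = ∑[ b ∶ n ↦ xs ] ∑[ M ∶ n ↦ zs ] h (y ∷ᶠ λ i → g (b i) (M i))
    ∼-∷ : ∀ {k} {y y′ : Y} {F G : Fin k → Y} → y ∼ y′ → (∀ i → F i ∼ G i) → ∀ i → (y ∷ᶠ F) i ∼ (y′ ∷ᶠ G) i
    ∼-∷ y∼y′ F∼G zero    = y∼y′
    ∼-∷ y∼y′ F∼G (suc i) = F∼G i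

  ∑ᶠ-insertCorner : {A : Set} (n m : ℕ) (v : Fin (suc n)) (w : Fin (suc m)) (xs : List A)
    (h : (Fin (suc n) → Fin (suc m) → A) → Carrier) → h Preserves _≗²_ ⟶ _≈_ →
    ∑ᶠ (suc n) (allFuns (suc m) xs) h
      ≈ ∑[ e ∈ xs ] ∑[ a ∶ m ↦ xs ] ∑[ b ∶ n ↦ xs ] ∑[ M ∶ n ↦ allFuns m xs ] h (insertCorner v w e a b M)
  ∑ᶠ-insertCorner n m v w xs h h-cong = begin
    ∑ᶠ (suc n) rows h
      ≈⟨ ∑ᶠ-insertAt n v rows h (λ F≡G → h-cong λ i → ≡.cong-app (F≡G i)) ⟩
    ∑[ r ∈ rows ] ∑[ F ∶ n ↦ rows ] h (insertAt F v r)
      ≈⟨ ∑-cong rows (λ r → ∑ᶠ-decompose _≗_ (λ _ → ≡.refl) rows xs (allFuns m xs) (λ β c → insertAt c w β)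
           (∑ᶠ-insertAt m w xs) n _ λ F≗G → h-cong (insertAt-pointwise _≗_ F≗G (λ _ → ≡.refl) v)) ⟩
    ∑[ r ∈ rows ] ∑[ b ∶ n ↦ xs ] ∑[ M ∶ n ↦ allFuns m xs ] h (insertAt (λ i → insertAt (M i) w (b i)) v r)
      ≈⟨ ∑ᶠ-insertAt m w xs _ (λ r≗r′ → ∑-cong (allFuns n xs) λ b → ∑-cong (allFuns n rows′) λ M →
           h-cong (insertAt-pointwise _≗_ (λ _ _ → ≡.refl) r≗r′ v)) ⟩
    ∑[ e ∈ xs ] ∑[ a ∶ m ↦ xs ] ∑[ b ∶ n ↦ xs ] ∑[ M ∶ n ↦ allFuns m xs ] h (insertCorner v w e a b M) ∎
    where
    rows = allFuns (suc m) xs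
    rows′ = allFuns m xs

  ∏-cong : (k : ℕ) {f g : Fin k → Carrier} → (∀ i → f i ≈ g i) → ∏ k f ≈ ∏ k g
  ∏-cong zero    f≈g = refl
  ∏-cong (suc k) f≈g = *-cong (f≈g zero) (∏-cong k (f≈g ∘ suc))

  ∏-distrib-* : (k : ℕ) (f g : Fin k → Carrier) → ∏[ i < k ] (f i * g i) ≈ ∏ k f * ∏ k g
  ∏-distrib-* zero    f g = sym (*-identityˡ 1#)
  ∏-distrib-* (suc k) f g =
    trans (*-congˡ (∏-distrib-* k (f ∘ suc) (g ∘ suc))) (*-Props.interchange _ _ _ _)

  ∏-const-1 : (k : ℕ) → ∏[ i < k ] 1# ≈ 1#
  ∏-const-1 zero    = refl
  ∏-const-1 (suc k) = trans (*-identityˡ _) (∏-const-1 k)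

  ∏-comm : (k l : ℕ) (f : Fin k → Fin l → Carrier) →
    ∏[ i < k ] ∏[ j < l ] f i j ≈ ∏[ j < l ] ∏[ i < k ] f i j
  ∏-comm zero    l f = sym (∏-const-1 l)
  ∏-comm (suc k) l f = trans (*-congˡ (∏-comm k l (f ∘ suc))) (sym (∏-distrib-* l _ _))

  ∏-punchIn : (k : ℕ) (v : Fin (suc k)) (f : Fin (suc k) → Carrier) →
    ∏ (suc k) f ≈ f v * ∏[ i < k ] f (punchIn v i)
  ∏-punchIn k       zero    f = refl
  ∏-punchIn (suc k) (suc v) f =
    trans (*-congˡ (∏-punchIn k v (f ∘ suc))) (*-Props.x∙yz≈y∙xz _ _ _)

  1#^n≈1# : (n : ℕ) → 1# ^ n ≈ 1#
  1#^n≈1# zero    = refl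
  1#^n≈1# (suc n) = trans (*-identityˡ _) (1#^n≈1# n)

  ^-distrib-∏ : (k e : ℕ) (f : Fin k → Carrier) → ∏ k f ^ e ≈ ∏[ i < k ] (f i ^ e)
  ^-distrib-∏ zero    e f = 1#^n≈1# e
  ^-distrib-∏ (suc k) e f = trans (Exp.^-distrib-* _ _ e) (*-congˡ (^-distrib-∏ k e (f ∘ suc)))

  ∑ᶠ-∏ : (k : ℕ) (xs : List A) (g : Fin k → A → Carrier) →
    ∑[ f ∶ k ↦ xs ] ∏[ i < k ] g i (f i) ≈ ∏[ i < k ] ∑ xs (g i)
  ∑ᶠ-∏ zero    xs g = +-identityʳ 1#
  ∑ᶠ-∏ (suc k) xs g = begin
    ∑ᶠ (suc k) xs (λ f → ∏[ i < suc k ] g i (f i))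
      ≈⟨ ∑ᶠ-suc k xs _ ⟩
    ∑[ z ∈ xs ] ∑[ f ∶ k ↦ xs ] (g zero z * ∏[ i < k ] g (suc i) (f i))
      ≈⟨ ∑-cong xs (λ z → sym (*-distribˡ-∑ (allFuns k xs) _ _)) ⟩
    ∑[ z ∈ xs ] (g zero z * ∑[ f ∶ k ↦ xs ] ∏[ i < k ] g (suc i) (f i))
      ≈⟨ ∑-cong xs (λ z → *-congˡ (∑ᶠ-∏ k xs (g ∘ suc))) ⟩
    ∑[ z ∈ xs ] (g zero z * ∏[ i < k ] ∑ xs (g (suc i)))
      ≈⟨ sym (*-distribʳ-∑ xs _ _) ⟩
    ∑ xs (g zero) * ∏[ i < k ] ∑ xs (g (suc i)) ∎

  ∏-count : (k : ℕ) (F : Bool → Carrier) (S : Fin k → Bool) →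
    ∏[ i < k ] F (S i) ≈ F true ^ countFin k S * F false ^ countFin k (not ∘ S)
  ∏-count zero    F S = sym (*-identityˡ 1#)
  ∏-count (suc k) F S with S zero
  ... | true  = trans (*-congˡ (∏-count k F (S ∘ suc))) (sym (*-assoc _ _ _))
  ... | false = trans (*-congˡ (∏-count k F (S ∘ suc))) (*-Props.x∙yz≈y∙xz _ _ _)

  ^-countFin : (z : Carrier) (k : ℕ) (X : Fin k → Bool) →
    z ^ countFin k X ≈ ∏[ i < k ] (if X i then z else 1#)
  ^-countFin z k X = sym (trans (∏-count k (λ b → if b then z else 1#) X)
    (trans (*-congˡ (1#^n≈1# (countFin k (not ∘ X)))) (*-identityʳ _)))

  ∏-count₂ : (k : ℕ) (F : Bool → Bool → Carrier) (T a : Fin k → Bool) →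
    ∏[ j < k ] F (T j) (a j) ≈
      F true true ^ countFin∧ k T a * (F true false ^ countFin∧ k T (not ∘ a)
        * (F false true ^ countFin∧ k (not ∘ T) a * F false false ^ countFin∧ k (not ∘ T) (not ∘ a)))
  ∏-count₂ zero F T a = sym (trans (*-identityˡ _) (trans (*-identityˡ _) (*-identityˡ _)))
  ∏-count₂ (suc k) F T a with T zero | a zero
  ... | true  | true  = trans (*-congˡ (∏-count₂ k F (T ∘ suc) (a ∘ suc))) (sym (*-assoc _ _ _))
  ... | true  | false = trans (*-congˡ (∏-count₂ k F (T ∘ suc) (a ∘ suc)))
    (solve 5 (λ z A B Γ D → z :* (A :* (B :* (Γ :* D))) := A :* ((z :* B) :* (Γ :* D))) refl _ _ _ _ _)
  ... | false | true  = trans (*-congˡ (∏-count₂ k F (T ∘ suc) (a ∘ suc)))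
    (solve 5 (λ z A B Γ D → z :* (A :* (B :* (Γ :* D))) := A :* (B :* ((z :* Γ) :* D))) refl _ _ _ _ _)
  ... | false | false = trans (*-congˡ (∏-count₂ k F (T ∘ suc) (a ∘ suc)))
    (solve 5 (λ z A B Γ D → z :* (A :* (B :* (Γ :* D))) := A :* (B :* (Γ :* (z :* D)))) refl _ _ _ _ _)

  ∑<-cong< : (k : ℕ) {f g : ℕ → Carrier} → (∀ i → i ℕ.< k → f i ≈ g i) → ∑< k f ≈ ∑< k g
  ∑<-cong< zero    f≈g = refl
  ∑<-cong< (suc k) f≈g = +-cong (∑<-cong< k λ i i<k → f≈g i (ℕP.m<n⇒m<1+n i<k)) (f≈g k (ℕP.n<1+n k))

  ∑<-cong : (k : ℕ) {f g : ℕ → Carrier} → (∀ i → f i ≈ g i) → ∑< k f ≈ ∑< k g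
  ∑<-cong k f≈g = ∑<-cong< k (λ i _ → f≈g i)

  ∑<-distrib-+ : (k : ℕ) (f g : ℕ → Carrier) → ∑[ i < k ] (f i + g i) ≈ ∑< k f + ∑< k g
  ∑<-distrib-+ zero    f g = sym (+-identityˡ 0#)
  ∑<-distrib-+ (suc k) f g = trans (+-congʳ (∑<-distrib-+ k f g)) (+-Props.interchange _ _ _ _)

  ∑<-suc : (k : ℕ) (f : ℕ → Carrier) → ∑< (suc k) f ≈ f 0 + ∑[ i < k ] f (suc i)
  ∑<-suc zero    f = trans (+-identityˡ _) (sym (+-identityʳ _))
  ∑<-suc (suc k) f = trans (+-congʳ (∑<-suc k f)) (+-assoc _ _ _)

  ×-zeroʳ : (a : ℕ) → a × 0# ≈ 0#
  ×-zeroʳ zero    = refl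
  ×-zeroʳ (suc a) = trans (+-identityˡ _) (×-zeroʳ a)

  ×-distrib-∑< : (a k : ℕ) (f : ℕ → Carrier) → a × ∑< k f ≈ ∑[ i < k ] (a × f i)
  ×-distrib-∑< a zero    f = ×-zeroʳ a
  ×-distrib-∑< a (suc k) f = trans (×-distrib-+ _ _ a) (+-congʳ (×-distrib-∑< a k f))

  -- pathSum l F sums F i j over the endpoints (i , j) of all 2 ^ l monotone lattice paths of length l.
  pathSum : ℕ → (ℕ → ℕ → Carrier) → Carrier
  pathSum zero    F = F 0 0
  pathSum (suc l) F = pathSum l (F ∘ suc) + pathSum l (λ i → F i ∘ suc)

  ∑ᶠ-count≈pathSum : (k : ℕ) (F : ℕ → ℕ → Carrier) →
    ∑[ S ∶ k ↦ bools ] F (countFin k S) (countFin k (not ∘ S)) ≈ pathSum k F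
  ∑ᶠ-count≈pathSum zero    F = +-identityʳ _
  ∑ᶠ-count≈pathSum (suc k) F = trans (∑ᶠ-suc k bools _)
    (+-cong (∑ᶠ-count≈pathSum k (F ∘ suc)) (trans (+-identityʳ _) (∑ᶠ-count≈pathSum k (λ i → F i ∘ suc))))

  pathSum≈binomialSum : (l : ℕ) (F : ℕ → ℕ → Carrier) → pathSum l F ≈ ∑[ i < suc l ] ((l C i) × F i (l ∸ i))
  pathSum≈binomialSum zero    F = sym (trans (+-identityˡ _) (+-identityʳ _))
  pathSum≈binomialSum (suc l) F = begin
    pathSum l (F ∘ suc) + pathSum l (λ i → F i ∘ suc)
      ≈⟨ +-cong (pathSum≈binomialSum l _) (pathSum≈binomialSum l _) ⟩
    ∑[ i < suc l ] ((l C i) × F (suc i) (l ∸ i)) + ∑[ i < suc l ] ((l C i) × F i (suc (l ∸ i)))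
      ≈⟨ +-congˡ (∑<-suc l _) ⟩
    ∑[ i < suc l ] ((l C i) × F (suc i) (l ∸ i)) + (1 × F 0 (suc l) + ∑[ i < l ] ((l C suc i) × F (suc i) (suc (l ∸ suc i))))
      ≈⟨ +-congˡ (+-congˡ (∑<-cong< l λ i i<l →
           ×-congʳ (l C suc i) (reflexive (≡.cong (F (suc i)) (≡.sym (ℕP.+-∸-assoc 1 i<l)))))) ⟩
    ∑[ i < suc l ] ((l C i) × F (suc i) (l ∸ i)) + (1 × F 0 (suc l) + ∑[ i < l ] ((l C suc i) × F (suc i) (l ∸ i)))
      ≈⟨ +-Props.x∙yz≈y∙xz _ _ _ ⟩
    1 × F 0 (suc l) + (∑[ i < suc l ] ((l C i) × F (suc i) (l ∸ i)) + ∑[ i < l ] ((l C suc i) × F (suc i) (l ∸ i)))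
      ≈⟨ +-congˡ (+-congˡ (sym lastTermVanishes)) ⟩
    1 × F 0 (suc l) + (∑[ i < suc l ] ((l C i) × F (suc i) (l ∸ i)) + ∑[ i < suc l ] ((l C suc i) × F (suc i) (l ∸ i)))
      ≈⟨ +-congˡ (sym (∑<-distrib-+ (suc l) _ _)) ⟩
    1 × F 0 (suc l) + ∑[ i < suc l ] ((l C i) × F (suc i) (l ∸ i) + (l C suc i) × F (suc i) (l ∸ i))
      ≈⟨ +-congˡ (∑<-cong (suc l) λ i → trans (sym (×-homo-+ _ (l C i) (l C suc i)))
           (reflexive (≡.cong (_× F (suc i) (l ∸ i)) (nCk+nC[k+1]≡[n+1]C[k+1] l i)))) ⟩
    1 × F 0 (suc l) + ∑[ i < suc l ] ((suc l C suc i) × F (suc i) (suc l ∸ suc i))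
      ≈⟨ sym (∑<-suc (suc l) _) ⟩
    ∑[ i < suc (suc l) ] ((suc l C i) × F i (suc l ∸ i)) ∎
    where
    lastTermVanishes : ∑[ i < suc l ] ((l C suc i) × F (suc i) (l ∸ i)) ≈ ∑[ i < l ] ((l C suc i) × F (suc i) (l ∸ i))
    lastTermVanishes = trans (+-congˡ (reflexive (≡.cong (_× F (suc l) (l ∸ l)) (k>n⇒nCk≡0 (ℕP.n<1+n l))))) (+-identityʳ _)

  ∑ᶠ-count-within : (k : ℕ) (T : Fin k → Bool) (F : ℕ → ℕ → Carrier) (u z : Carrier) →
    ∑[ a ∶ k ↦ bools ] (F (countFin∧ k T a) (countFin∧ k T (not ∘ a))
                         * (u ^ countFin∧ k (not ∘ T) a * z ^ countFin∧ k (not ∘ T) (not ∘ a)))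
      ≈ pathSum (countFin k T) F * (u + z) ^ countFin k (not ∘ T)
  ∑ᶠ-count-within zero    T F u z = trans (+-identityʳ _) (*-congˡ (*-identityʳ _))
  ∑ᶠ-count-within (suc k) T F u z with T zero
  ... | true  = trans (∑ᶠ-suc k bools _)
    (trans (+-cong (∑ᶠ-count-within k (T ∘ suc) (F ∘ suc) u z)
                   (trans (+-identityʳ _) (∑ᶠ-count-within k (T ∘ suc) (λ i → F i ∘ suc) u z)))
           (sym (distribʳ _ _ _)))
  ... | false = trans (∑ᶠ-suc k bools _)
    (trans (+-cong (factorOut u (λ P X Y → P * ((u * X) * Y))
                     (λ P X Y → solve 4 (λ P X Y c → P :* ((c :* X) :* Y) := c :* (P :* (X :* Y))) refl P X Y u))
                   (+-congʳ (factorOut z (λ P X Y → P * (X * (z * Y)))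
                     (λ P X Y → solve 4 (λ P X Y c → P :* (X :* (c :* Y)) := c :* (P :* (X :* Y))) refl P X Y z))))
           (solve 4 (λ u z B Z → u :* (B :* Z) :+ (z :* (B :* Z) :+ con 0) := B :* ((u :+ z) :* Z)) refl u z _ _))
    where
    factorOut : (c : Carrier) (G : Carrier → Carrier → Carrier → Carrier) →
      (∀ P X Y → G P X Y ≈ c * (P * (X * Y))) →
      ∑[ a ∶ k ↦ bools ] G (F (countFin∧ k (T ∘ suc) a) (countFin∧ k (T ∘ suc) (not ∘ a)))
                           (u ^ countFin∧ k (not ∘ T ∘ suc) a) (z ^ countFin∧ k (not ∘ T ∘ suc) (not ∘ a))
        ≈ c * (pathSum (countFin k (T ∘ suc)) F * (u + z) ^ countFin k (not ∘ T ∘ suc))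
    factorOut c G G≈ = trans (∑-cong (allFuns k bools) λ a → G≈ _ _ _)
      (trans (sym (*-distribˡ-∑ (allFuns k bools) c _)) (*-congˡ (∑ᶠ-count-within k (T ∘ suc) F u z)))

  1-z+z≈1 : (z : Carrier) → (1# - z) + z ≈ 1#
  1-z+z≈1 z = trans (+-assoc _ _ _) (trans (+-congˡ (-‿inverseˡ z)) (+-identityʳ _))

  mark : Carrier → Bool → Carrier
  mark z s = if s then 1# - z else z

  avoid : Bool → Bool → Carrier
  avoid s b = if s ∧ b then 0# else 1#

  ∑-mark-avoid : (z : Carrier) (b : Bool) → ∑[ s ∈ bools ] (mark z s * avoid s b) ≈ (if b then z else 1#)
  ∑-mark-avoid z true  = trans (+-cong (zeroʳ _) (+-identityʳ _)) (trans (+-identityˡ _) (*-identityʳ _))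
  ∑-mark-avoid z false = trans (+-cong (*-identityʳ _) (trans (+-identityʳ _) (*-identityʳ _))) (1-z+z≈1 z)

  ^-countFin-expand : (z : Carrier) (k : ℕ) (X : Fin k → Bool) →
    z ^ countFin k X ≈ ∑[ S ∶ k ↦ bools ] (∏[ i < k ] mark z (S i) * ∏[ i < k ] avoid (S i) (X i))
  ^-countFin-expand z k X = begin
    z ^ countFin k X                                              ≈⟨ ^-countFin z k X ⟩
    ∏[ i < k ] (if X i then z else 1#)                            ≈⟨ ∏-cong k (λ i → sym (∑-mark-avoid z (X i))) ⟩
    ∏[ i < k ] ∑[ s ∈ bools ] (mark z s * avoid s (X i))          ≈⟨ sym (∑ᶠ-∏ k bools λ i s → mark z s * avoid s (X i)) ⟩
    ∑[ S ∶ k ↦ bools ] ∏[ i < k ] (mark z (S i) * avoid (S i) (X i)) ≈⟨ ∑-cong (allFuns k bools) (λ S → ∏-distrib-* k _ _) ⟩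
    ∑[ S ∶ k ↦ bools ] (∏[ i < k ] mark z (S i) * ∏[ i < k ] avoid (S i) (X i)) ∎

  avoid-false : (s : Bool) → avoid s false ≈ 1#
  avoid-false true  = refl
  avoid-false false = refl

  avoid-∨ : (s b d : Bool) → avoid s (b ∨ d) ≈ avoid s b * avoid s d
  avoid-∨ false b     d     = sym (*-identityˡ 1#)
  avoid-∨ true  true  d     = sym (zeroˡ _)
  avoid-∨ true  false true  = sym (zeroʳ _)
  avoid-∨ true  false false = sym (*-identityˡ 1#)

  avoid-anyFin : (s : Bool) (k : ℕ) (Q : Fin k → Bool) → avoid s (anyFin k Q) ≈ ∏[ j < k ] avoid s (Q j)
  avoid-anyFin s zero    Q = avoid-false s
  avoid-anyFin s (suc k) Q = trans (avoid-∨ s (Q zero) _) (*-congˡ (avoid-anyFin s k (Q ∘ suc)))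

  ∑ᶠ-count≈binomialSum : (k : ℕ) (F : ℕ → ℕ → Carrier) →
    ∑[ S ∶ k ↦ bools ] F (countFin k S) (countFin k (not ∘ S)) ≈ ∑[ i < suc k ] ((k C i) × F i (k ∸ i))
  ∑ᶠ-count≈binomialSum k F = trans (∑ᶠ-count≈pathSum k F) (pathSum≈binomialSum k F)

module RandomBipartiteGraph {c ℓ : Level} (R : CommutativeRing c ℓ) (p x y : CommutativeRing.Carrier R) where
  open CommutativeRing R hiding (zero)
  open RawSemiringDefs (Algebra.Bundles.Semiring.rawSemiring semiring) using (_^_; _×_)
  open import Relation.Binary.Reasoning.Setoid setoid
  open FiniteSums R
  open import Algebra.Properties.Monoid.Mult +-monoid using (×-congʳ)
  import Algebra.Properties.CommutativeSemiring.Exp commutativeSemiring as Exp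
  open import Algebra.Properties.Semiring.Exp semiring using (^-congˡ; ^-congʳ; ^-homo-*; ^-assocʳ)
  open import Algebra.Solver.Ring.NaturalCoefficients.Default commutativeSemiring using (solve; _:+_; _:*_; _:=_; con)

  q : Carrier
  q = 1# - p

  edgeProb : Bool → Carrier
  edgeProb b = if b then p else q

  -- Summing out one entry of M: the edge is forbidden exactly when it would make a marked
  -- vertex of V adjacent to v, or a marked vertex of W adjacent to w.
  cellFactor : Bool → Bool → Bool → Bool → Carrier
  cellFactor s α t β = if (s ∧ α) ∨ (t ∧ β) then q else 1#

  private
    blocked : ∀ {u} → u ≈ 0# → p * u + (q * (1# * 1#) + 0#) ≈ q
    blocked u≈0 = trans (+-cong (trans (*-congˡ u≈0) (zeroʳ p)) (trans (+-identityʳ _) (*-congˡ (*-identityˡ 1#))))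
                        (trans (+-identityˡ _) (*-identityʳ q))

    free : p * (1# * 1#) + (q * (1# * 1#) + 0#) ≈ 1#
    free = begin
      p * (1# * 1#) + (q * (1# * 1#) + 0#) ≈⟨ +-cong (*-congˡ (*-identityˡ 1#)) (trans (+-identityʳ _) (*-congˡ (*-identityˡ 1#))) ⟩
      p * 1# + q * 1#                      ≈⟨ +-cong (*-identityʳ p) (*-identityʳ q) ⟩
      p + q                                ≈⟨ +-comm p q ⟩
      q + p                                ≈⟨ 1-z+z≈1 p ⟩
      1#                                   ∎

  ∑-cell : ∀ s α t β → ∑[ γ ∈ bools ] (edgeProb γ * (avoid s (α ∧ γ) * avoid t (β ∧ γ))) ≈ cellFactor s α t β
  ∑-cell true  true  true  true  = blocked (zeroˡ _)
  ∑-cell true  true  true  false = blocked (zeroˡ _)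
  ∑-cell true  true  false true  = blocked (zeroˡ _)
  ∑-cell true  true  false false = blocked (zeroˡ _)
  ∑-cell true  false true  true  = blocked (zeroʳ _)
  ∑-cell true  false true  false = free
  ∑-cell true  false false true  = free
  ∑-cell true  false false false = free
  ∑-cell false true  true  true  = blocked (zeroʳ _)
  ∑-cell false true  true  false = free
  ∑-cell false true  false true  = free
  ∑-cell false true  false false = free
  ∑-cell false false true  true  = blocked (zeroʳ _)
  ∑-cell false false true  false = free
  ∑-cell false false false true  = free
  ∑-cell false false false false = free

  cellFactor-edge : ∀ s α t → cellFactor s α t true ≡ (if (s ∧ α) ∨ t then q else 1#)
  cellFactor-edge s α t = ≡.cong (λ c → if (s ∧ α) ∨ c then q else 1#) (BoolP.∧-identityʳ t)

  cellFactor-nonedge : ∀ s α t → cellFactor s α t false ≡ (if s ∧ α then q else 1#)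
  cellFactor-nonedge s α t = ≡.cong (λ c → if c then q else 1#)
    (≡.trans (≡.cong ((s ∧ α) ∨_) (BoolP.∧-zeroʳ t)) (BoolP.∨-identityʳ (s ∧ α)))

  missProb : ℕ → Carrier
  missProb l = q + p * q ^ l

  pathWeight : ℕ → ℕ → ℕ → ℕ → Carrier
  pathWeight k l i j = p ^ i * q ^ j * (q ^ suc i + p * q ^ l) ^ k

  -- The probability that none of k marked vertices of V ∖ {v} is an active neighbour of v and
  -- none of l marked vertices of W ∖ {w} a passive neighbour of w, with k′ and l′ unmarked
  -- vertices; the first summand is the case vw ∈ E.
  avoidanceFormula : ℕ → ℕ → ℕ → ℕ → Carrier
  avoidanceFormula k k′ l l′ = (p * (q ^ k * missProb l ^ k′)) * (q ^ l * missProb k ^ l′)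
    + (q * missProb l ^ k′) * (pathSum l (pathWeight k l) * (p * q ^ k + q) ^ l′)

  neighbourFactor : ℕ → Bool → Bool → Carrier
  neighbourFactor k t α = (edgeProb α * avoid t α) * (if α then q ^ k else 1#)

  ∑-neighbourFactor : (k : ℕ) (t : Bool) → ∑[ α ∈ bools ] neighbourFactor k t α ≈ (if t then q else missProb k)
  ∑-neighbourFactor k true  = solve 3 (λ p Q q → (p :* con 0) :* Q :+ ((q :* con 1) :* con 1 :+ con 0) := q) refl p _ q
  ∑-neighbourFactor k false = solve 3 (λ p Q q → (p :* con 1) :* Q :+ ((q :* con 1) :* con 1 :+ con 0) := q :+ p :* Q) refl p _ q

  ^-if : (k : ℕ) (α : Bool) → (if α then q else 1#) ^ k ≈ (if α then q ^ k else 1#)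
  ^-if k true  = refl
  ^-if k false = 1#^n≈1# k

  module Corner (n m : ℕ) where

    CornerFunction : Set c
    CornerFunction = Bool → (Fin m → Bool) → (Fin n → Bool) → (Fin n → Fin m → Bool) → Carrier

    activeAt : Bool → (Fin m → Bool) → (Fin n → Bool) → (Fin n → Fin m → Bool) → Fin n → Bool
    activeAt e a b M i = (e ∧ b i) ∨ anyFin m (λ j → a j ∧ M i j)

    passiveAt : Bool → (Fin m → Bool) → (Fin n → Bool) → (Fin n → Fin m → Bool) → Fin m → Bool
    passiveAt e a b M j = (e ∧ a j) ∨ anyFin n (λ i → b i ∧ M i j)

    cornerWeight : CornerFunction
    cornerWeight e a b M = (edgeProb e * ∏[ j < m ] edgeProb (a j)) * ∏[ i < n ] (edgeProb (b i) * ∏[ j < m ] edgeProb (M i j))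

    cornerTerm : CornerFunction
    cornerTerm e a b M = cornerWeight e a b M * (x ^ countFin n (activeAt e a b M) * y ^ countFin m (passiveAt e a b M))

    ∑corner : CornerFunction → Carrier
    ∑corner h = ∑[ e ∈ bools ] ∑[ a ∶ m ↦ bools ] ∑[ b ∶ n ↦ bools ] ∑[ M ∶ n ↦ allFuns m bools ] h e a b M

    cornerTerm-cong : ∀ {e e′ a a′ b b′ M M′} → e ≡ e′ → a ≗ a′ → b ≗ b′ → M ≗² M′ →
      cornerTerm e a b M ≈ cornerTerm e′ a′ b′ M′
    cornerTerm-cong ≡.refl a≗a′ b≗b′ M≗M′ = *-cong
      (*-cong (*-congˡ (∏-cong m λ j → reflexive (≡.cong edgeProb (a≗a′ j))))
              (∏-cong n λ i → *-cong (reflexive (≡.cong edgeProb (b≗b′ i))) (∏-cong m λ j → reflexive (≡.cong edgeProb (M≗M′ i j)))))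
      (*-cong (reflexive (≡.cong (x ^_) (countFin-cong n λ i → ≡.cong₂ _∨_ (≡.cong (_ ∧_) (b≗b′ i))
                 (anyFin-cong m λ j → ≡.cong₂ _∧_ (a≗a′ j) (M≗M′ i j)))))
              (reflexive (≡.cong (y ^_) (countFin-cong m λ j → ≡.cong₂ _∨_ (≡.cong (_ ∧_) (a≗a′ j))
                 (anyFin-cong n λ i → ≡.cong₂ _∧_ (b≗b′ i) (M≗M′ i j))))))

    ∑corner-cong : {h h′ : CornerFunction} →
      (∀ e a b M → h e a b M ≈ h′ e a b M) → ∑corner h ≈ ∑corner h′
    ∑corner-cong h≈h′ = ∑-cong bools λ e → ∑-cong (allFuns m bools) λ a → ∑-cong (allFuns n bools) λ b →
      ∑-cong (allFuns n (allFuns m bools)) (h≈h′ e a b)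

    module _ (v : Fin (suc n)) (w : Fin (suc m)) where

      atCorner : CornerFunction → (Fin (suc n) → Fin (suc m) → Bool) → Carrier
      atCorner h E = h (E v w) (E v ∘ punchIn w) (λ i → E (punchIn v i) w) (λ i j → E (punchIn v i) (punchIn w j))

      degActive-corner : (E : Fin (suc n) → Fin (suc m) → Bool) →
        degActive E v ≡ countFin n (activeAt (E v w) (E v ∘ punchIn w) (λ i → E (punchIn v i) w) (λ i j → E (punchIn v i) (punchIn w j)))
      degActive-corner E = ≡.trans (countFin-punchIn n v (activeAdj E v)) (≡.cong₂ ℕ._+_
        (≡.cong (λ d → if not d ∧ common v then 1 else 0) (isYes-≟-diag v))
        (countFin-cong n λ i → ≡.trans (≡.cong (λ d → not d ∧ common (punchIn v i)) (isYes-≟-punchIn v i))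
                                       (anyFin-punchIn m w (λ c → E v c ∧ E (punchIn v i) c))))
        where
        common : Fin (suc n) → Bool
        common u = anyFin (suc m) (λ c → E v c ∧ E u c)

      degPassive-corner : (E : Fin (suc n) → Fin (suc m) → Bool) →
        degPassive E w ≡ countFin m (passiveAt (E v w) (E v ∘ punchIn w) (λ i → E (punchIn v i) w) (λ i j → E (punchIn v i) (punchIn w j)))
      degPassive-corner E = ≡.trans (countFin-punchIn m w (passiveAdj E w)) (≡.cong₂ ℕ._+_
        (≡.cong (λ d → if not d ∧ common w then 1 else 0) (isYes-≟-diag w))
        (countFin-cong m λ j → ≡.trans (≡.cong (λ d → not d ∧ common (punchIn w j)) (isYes-≟-punchIn w j))
                                       (anyFin-punchIn n v (λ u → E u w ∧ E u (punchIn w j)))))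
        where
        common : Fin (suc m) → Bool
        common c = anyFin (suc n) (λ u → E u w ∧ E u c)

      graphTerm≈atCorner : (E : Fin (suc n) → Fin (suc m) → Bool) →
        graphProb R p E * (x ^ degActive E v * y ^ degPassive E w) ≈ atCorner cornerTerm E
      graphTerm≈atCorner E = *-cong
        (trans (∏-punchIn n v λ u → ∏[ c < suc m ] edgeProb (E u c))
               (*-cong (∏-punchIn m w (edgeProb ∘ E v)) (∏-cong n λ i → ∏-punchIn m w (edgeProb ∘ E (punchIn v i)))))
        (*-cong (reflexive (≡.cong (x ^_) (degActive-corner E))) (reflexive (≡.cong (y ^_) (degPassive-corner E))))

      atCorner-insertCorner : ∀ e a b M → atCorner cornerTerm (insertCorner v w e a b M) ≈ cornerTerm e a b M
      atCorner-insertCorner e a b M = cornerTerm-cong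
        (≡.trans (≡.cong-app row-v w) (insertAt-lookup a w e))
        (λ j → ≡.trans (≡.cong-app row-v (punchIn w j)) (insertAt-punchIn a w e j))
        (λ i → ≡.trans (≡.cong-app (row-punchIn i) w) (insertAt-lookup (M i) w (b i)))
        (λ i j → ≡.trans (≡.cong-app (row-punchIn i) (punchIn w j)) (insertAt-punchIn (M i) w (b i) j))
        where
        row-v : insertCorner v w e a b M v ≡ insertAt a w e
        row-v = insertAt-lookup _ v _
        row-punchIn : ∀ i → insertCorner v w e a b M (punchIn v i) ≡ insertAt (M i) w (b i)
        row-punchIn = insertAt-punchIn _ v _

      jointPGF≈∑corner : jointPGF R (suc n) (suc m) v w p x y ≈ ∑corner cornerTerm
      jointPGF≈∑corner = begin
        jointPGF R (suc n) (suc m) v w p x y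
          ≈⟨ ∑-cong (allBipGraphs (suc n) (suc m)) graphTerm≈atCorner ⟩
        ∑ᶠ (suc n) (allFuns (suc m) bools) (atCorner cornerTerm)
          ≈⟨ ∑ᶠ-insertCorner n m v w bools _ (λ E≗E′ → cornerTerm-cong (E≗E′ v w) (E≗E′ v ∘ punchIn w)
               (λ i → E≗E′ (punchIn v i) w) (λ i j → E≗E′ (punchIn v i) (punchIn w j))) ⟩
        ∑corner (λ e a b M → atCorner cornerTerm (insertCorner v w e a b M))
          ≈⟨ ∑corner-cong atCorner-insertCorner ⟩
        ∑corner cornerTerm ∎

    ∑corner-comm : {A : Set} (zs : List A) (h : A → CornerFunction) →
      ∑corner (λ e a b M → ∑[ z ∈ zs ] h z e a b M) ≈ ∑[ z ∈ zs ] ∑corner (h z)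
    ∑corner-comm zs h =
      trans (∑-cong bools λ e → ∑-cong (allFuns m bools) λ a → ∑-cong (allFuns n bools) λ b →
               ∑-comm (allFuns n (allFuns m bools)) zs (λ M z → h z e a b M))
      (trans (∑-cong bools λ e → ∑-cong (allFuns m bools) λ a →
               ∑-comm (allFuns n bools) zs (λ b z → ∑[ M ∶ n ↦ allFuns m bools ] h z e a b M))
      (trans (∑-cong bools λ e →
               ∑-comm (allFuns m bools) zs (λ a z → ∑[ b ∶ n ↦ bools ] ∑[ M ∶ n ↦ allFuns m bools ] h z e a b M))
             (∑-comm bools zs (λ e z → ∑[ a ∶ m ↦ bools ] ∑[ b ∶ n ↦ bools ] ∑[ M ∶ n ↦ allFuns m bools ] h z e a b M))))

    *-distribˡ-∑corner : (k : Carrier) (h : CornerFunction) →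
      k * ∑corner h ≈ ∑corner (λ e a b M → k * h e a b M)
    *-distribˡ-∑corner k h =
      trans (*-distribˡ-∑ bools k λ e → ∑[ a ∶ m ↦ bools ] ∑[ b ∶ n ↦ bools ] ∑[ M ∶ n ↦ allFuns m bools ] h e a b M)
      (∑-cong bools λ e → trans
        (*-distribˡ-∑ (allFuns m bools) k λ a → ∑[ b ∶ n ↦ bools ] ∑[ M ∶ n ↦ allFuns m bools ] h e a b M)
      (∑-cong (allFuns m bools) λ a → trans (*-distribˡ-∑ (allFuns n bools) k λ b → ∑[ M ∶ n ↦ allFuns m bools ] h e a b M)
      (∑-cong (allFuns n bools) λ b → *-distribˡ-∑ (allFuns n (allFuns m bools)) k (h e a b))))

    avoidanceIntegrand : (Fin n → Bool) → (Fin m → Bool) → CornerFunction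
    avoidanceIntegrand S T e a b M = cornerWeight e a b M
      * (∏[ i < n ] avoid (S i) (activeAt e a b M i) * ∏[ j < m ] avoid (T j) (passiveAt e a b M j))

    avoidanceProb : (Fin n → Bool) → (Fin m → Bool) → Carrier
    avoidanceProb S T = ∑corner (avoidanceIntegrand S T)

    markWeight : (Fin n → Bool) → (Fin m → Bool) → Carrier
    markWeight S T = ∏[ i < n ] mark x (S i) * ∏[ j < m ] mark y (T j)

    cornerTerm-expand : ∀ e a b M →
      cornerTerm e a b M ≈ ∑[ S ∶ n ↦ bools ] ∑[ T ∶ m ↦ bools ] (markWeight S T * avoidanceIntegrand S T e a b M)
    cornerTerm-expand e a b M = begin
      W * (x ^ countFin n (activeAt e a b M) * y ^ countFin m (passiveAt e a b M))
        ≈⟨ *-congˡ (*-cong (^-countFin-expand x n _) (^-countFin-expand y m _)) ⟩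
      W * (∑ (allFuns n bools) f * ∑ (allFuns m bools) g)
        ≈⟨ *-congˡ (*-distribʳ-∑ (allFuns n bools) _ f) ⟩
      W * ∑[ S ∶ n ↦ bools ] (f S * ∑ (allFuns m bools) g)
        ≈⟨ *-distribˡ-∑ (allFuns n bools) W _ ⟩
      ∑[ S ∶ n ↦ bools ] (W * (f S * ∑ (allFuns m bools) g))
        ≈⟨ ∑-cong (allFuns n bools) (λ S → trans (*-congˡ (*-distribˡ-∑ (allFuns m bools) (f S) g))
             (trans (*-distribˡ-∑ (allFuns m bools) W _) (∑-cong (allFuns m bools) λ T → rearrange _ _ _ _ _))) ⟩
      ∑[ S ∶ n ↦ bools ] ∑[ T ∶ m ↦ bools ] (markWeight S T * avoidanceIntegrand S T e a b M) ∎
      where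
      W = cornerWeight e a b M
      f : (Fin n → Bool) → Carrier
      f S = ∏[ i < n ] mark x (S i) * ∏[ i < n ] avoid (S i) (activeAt e a b M i)
      g : (Fin m → Bool) → Carrier
      g T = ∏[ j < m ] mark y (T j) * ∏[ j < m ] avoid (T j) (passiveAt e a b M j)
      rearrange : ∀ W a b c d → W * ((a * b) * (c * d)) ≈ (a * c) * (W * (b * d))
      rearrange = solve 5 (λ W a b c d → W :* ((a :* b) :* (c :* d)) := (a :* c) :* (W :* (b :* d))) refl

    ∑corner≈∑markWeight : ∑corner cornerTerm ≈ ∑[ S ∶ n ↦ bools ] ∑[ T ∶ m ↦ bools ] (markWeight S T * avoidanceProb S T)
    ∑corner≈∑markWeight = begin
      ∑corner cornerTerm
        ≈⟨ ∑corner-cong cornerTerm-expand ⟩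
      ∑corner (λ e a b M → ∑[ S ∶ n ↦ bools ] ∑[ T ∶ m ↦ bools ] (markWeight S T * avoidanceIntegrand S T e a b M))
        ≈⟨ ∑corner-comm (allFuns n bools) (λ S e a b M → ∑[ T ∶ m ↦ bools ] (markWeight S T * avoidanceIntegrand S T e a b M)) ⟩
      ∑[ S ∶ n ↦ bools ] ∑corner (λ e a b M → ∑[ T ∶ m ↦ bools ] (markWeight S T * avoidanceIntegrand S T e a b M))
        ≈⟨ ∑-cong (allFuns n bools) (λ S →
             ∑corner-comm (allFuns m bools) λ T e a b M → markWeight S T * avoidanceIntegrand S T e a b M) ⟩
      ∑[ S ∶ n ↦ bools ] ∑[ T ∶ m ↦ bools ] ∑corner (λ e a b M → markWeight S T * avoidanceIntegrand S T e a b M)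
        ≈⟨ ∑-cong (allFuns n bools) (λ S → ∑-cong (allFuns m bools) λ T →
             sym (*-distribˡ-∑corner (markWeight S T) (avoidanceIntegrand S T))) ⟩
      ∑[ S ∶ n ↦ bools ] ∑[ T ∶ m ↦ bools ] (markWeight S T * avoidanceProb S T) ∎

    rootFactor : (Fin m → Bool) → Bool → (Fin m → Bool) → Carrier
    rootFactor T e a = edgeProb e * ∏[ j < m ] (edgeProb (a j) * avoid (T j) (e ∧ a j))

    vertexFactor : (Fin m → Bool) → Bool → Bool → (Fin m → Bool) → Carrier
    vertexFactor T s e a = ∑[ β ∈ bools ] ((edgeProb β * avoid s (e ∧ β)) * ∏[ j < m ] cellFactor s (a j) (T j) β)

    avoidanceIntegrand-factor : ∀ S T e a b M → avoidanceIntegrand S T e a b M ≈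
      rootFactor T e a * ∏[ i < n ] ((edgeProb (b i) * avoid (S i) (e ∧ b i))
        * ∏[ j < m ] (edgeProb (M i j) * (avoid (S i) (a j ∧ M i j) * avoid (T j) (b i ∧ M i j))))
    avoidanceIntegrand-factor S T e a b M = begin
      avoidanceIntegrand S T e a b M
        ≈⟨ *-cong (*-congˡ (∏-distrib-* n _ _))
                  (*-cong (trans (∏-cong n λ i → trans (avoid-∨ (S i) (e ∧ b i) _) (*-congˡ (avoid-anyFin (S i) m _)))
                                 (∏-distrib-* n _ _))
                          (trans (∏-cong m λ j → trans (avoid-∨ (T j) (e ∧ a j) _) (*-congˡ (avoid-anyFin (T j) n _)))
                                 (trans (∏-distrib-* m _ _) (*-congˡ (∏-comm m n λ j i → avoid (T j) (b i ∧ M i j)))))) ⟩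
      ((edgeProb e * ∏[ j < m ] edgeProb (a j)) * (∏[ i < n ] edgeProb (b i) * ∏[ i < n ] ∏[ j < m ] edgeProb (M i j)))
        * ((∏[ i < n ] avoid (S i) (e ∧ b i) * ∏[ i < n ] ∏[ j < m ] avoid (S i) (a j ∧ M i j))
          * (∏[ j < m ] avoid (T j) (e ∧ a j) * ∏[ i < n ] ∏[ j < m ] avoid (T j) (b i ∧ M i j)))
        ≈⟨ solve 8 (λ pe A B Γ X₁ X₂ Y₁ Y₂ → ((pe :* A) :* (B :* Γ)) :* ((X₁ :* X₂) :* (Y₁ :* Y₂))
                                           := (pe :* (A :* Y₁)) :* ((B :* X₁) :* (Γ :* (X₂ :* Y₂)))) refl _ _ _ _ _ _ _ _ ⟩
      (edgeProb e * (∏[ j < m ] edgeProb (a j) * ∏[ j < m ] avoid (T j) (e ∧ a j)))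
        * ((∏[ i < n ] edgeProb (b i) * ∏[ i < n ] avoid (S i) (e ∧ b i))
          * (∏[ i < n ] ∏[ j < m ] edgeProb (M i j)
            * (∏[ i < n ] ∏[ j < m ] avoid (S i) (a j ∧ M i j) * ∏[ i < n ] ∏[ j < m ] avoid (T j) (b i ∧ M i j))))
        ≈⟨ sym (*-cong (*-congˡ (∏-distrib-* m _ _))
             (trans (∏-cong n λ i → *-congˡ (trans (∏-distrib-* m _ _) (*-congˡ (∏-distrib-* m _ _))))
                    (trans (∏-distrib-* n _ _) (*-cong (∏-distrib-* n _ _) (trans (∏-distrib-* n _ _) (*-congˡ (∏-distrib-* n _ _))))))) ⟩
      rootFactor T e a * ∏[ i < n ] ((edgeProb (b i) * avoid (S i) (e ∧ b i))
        * ∏[ j < m ] (edgeProb (M i j) * (avoid (S i) (a j ∧ M i j) * avoid (T j) (b i ∧ M i j)))) ∎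

    ∑-rest : (S : Fin n → Bool) (T : Fin m → Bool) (e : Bool) (a : Fin m → Bool) (b : Fin n → Bool) →
      ∑[ M ∶ n ↦ allFuns m bools ] (rootFactor T e a * ∏[ i < n ] ((edgeProb (b i) * avoid (S i) (e ∧ b i))
        * ∏[ j < m ] (edgeProb (M i j) * (avoid (S i) (a j ∧ M i j) * avoid (T j) (b i ∧ M i j)))))
      ≈ rootFactor T e a * ∏[ i < n ] ((edgeProb (b i) * avoid (S i) (e ∧ b i)) * ∏[ j < m ] cellFactor (S i) (a j) (T j) (b i))
    ∑-rest S T e a b = trans (sym (*-distribˡ-∑ (allFuns n (allFuns m bools)) (rootFactor T e a) _))
      (*-congˡ (trans (∑ᶠ-∏ n (allFuns m bools) λ i r → (edgeProb (b i) * avoid (S i) (e ∧ b i))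
                         * ∏[ j < m ] (edgeProb (r j) * (avoid (S i) (a j ∧ r j) * avoid (T j) (b i ∧ r j))))
        (∏-cong n λ i → trans (sym (*-distribˡ-∑ (allFuns m bools) (edgeProb (b i) * avoid (S i) (e ∧ b i)) _))
          (*-congˡ (trans (∑ᶠ-∏ m bools λ j γ → edgeProb γ * (avoid (S i) (a j ∧ γ) * avoid (T j) (b i ∧ γ)))
            (∏-cong m λ j → ∑-cell (S i) (a j) (T j) (b i)))))))

    ∑-column : (S : Fin n → Bool) (T : Fin m → Bool) (e : Bool) (a : Fin m → Bool) →
      ∑[ b ∶ n ↦ bools ] (rootFactor T e a
        * ∏[ i < n ] ((edgeProb (b i) * avoid (S i) (e ∧ b i)) * ∏[ j < m ] cellFactor (S i) (a j) (T j) (b i)))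
      ≈ rootFactor T e a * (vertexFactor T true e a ^ countFin n S * vertexFactor T false e a ^ countFin n (not ∘ S))
    ∑-column S T e a = trans (sym (*-distribˡ-∑ (allFuns n bools) (rootFactor T e a) _))
      (*-congˡ (trans (∑ᶠ-∏ n bools λ i β → (edgeProb β * avoid (S i) (e ∧ β)) * ∏[ j < m ] cellFactor (S i) (a j) (T j) β)
        (∏-count n (λ s → vertexFactor T s e a) S)))

    avoidanceProb-factor : (S : Fin n → Bool) (T : Fin m → Bool) → avoidanceProb S T ≈ ∑[ e ∈ bools ] ∑[ a ∶ m ↦ bools ]
      (rootFactor T e a * (vertexFactor T true e a ^ countFin n S * vertexFactor T false e a ^ countFin n (not ∘ S)))
    avoidanceProb-factor S T = ∑-cong bools λ e → ∑-cong (allFuns m bools) λ a → trans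
      (∑-cong (allFuns n bools) λ b → trans (∑-cong (allFuns n (allFuns m bools)) (avoidanceIntegrand-factor S T e a b))
                                             (∑-rest S T e a b))
      (∑-column S T e a)

    vertexFactor-unmarked : (T : Fin m → Bool) (e : Bool) (a : Fin m → Bool) → vertexFactor T false e a ≈ missProb (countFin m T)
    vertexFactor-unmarked T e a = trans
      (+-cong (*-congˡ (trans (∏-cong m λ j → reflexive (cellFactor-edge false (a j) (T j))) (sym (^-countFin q m T))))
              (+-congʳ (*-congˡ (trans (∏-cong m λ j → reflexive (cellFactor-nonedge false (a j) (T j))) (∏-const-1 m)))))
      (solve 3 (λ p Q q → (p :* con 1) :* Q :+ ((q :* con 1) :* con 1 :+ con 0) := q :+ p :* Q) refl p _ q)

    vertexFactor-marked-at-edge : (T a : Fin m → Bool) → vertexFactor T true true a ≈ q * ∏[ j < m ] (if a j then q else 1#)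
    vertexFactor-marked-at-edge T a = trans
      (+-congˡ (+-congʳ (*-congˡ (∏-cong m λ j → reflexive (cellFactor-nonedge true (a j) (T j))))))
      (solve 4 (λ p X q Y → (p :* con 0) :* X :+ ((q :* con 1) :* Y :+ con 0) := q :* Y) refl p _ q _)

    vertexFactor-marked-at-nonedge : (T a : Fin m → Bool) → vertexFactor T true false a ≈
      q ^ countFin∧ m (not ∘ T) a * (q ^ suc (countFin∧ m T a) + p * q ^ countFin m T)
    vertexFactor-marked-at-nonedge T a = begin
      vertexFactor T true false a
        ≈⟨ +-cong (*-congˡ (∏-cong m λ j → reflexive (cellFactor-edge true (a j) (T j))))
                  (+-congʳ (*-congˡ (∏-cong m λ j → reflexive (cellFactor-nonedge true (a j) (T j))))) ⟩
      (p * 1#) * ∏[ j < m ] (if a j ∨ T j then q else 1#) + ((q * 1#) * ∏[ j < m ] (if a j then q else 1#) + 0#)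
        ≈⟨ +-cong (*-congˡ (∏-count₂ m (λ t α → if α ∨ t then q else 1#) T a))
                  (+-congʳ (*-congˡ (∏-count₂ m (λ t α → if α then q else 1#) T a))) ⟩
      (p * 1#) * (q ^ A * (q ^ B * (q ^ C′ * 1# ^ D))) + ((q * 1#) * (q ^ A * (1# ^ B * (q ^ C′ * 1# ^ D))) + 0#)
        ≈⟨ +-cong (*-congˡ (*-congˡ (*-congˡ (*-congˡ (1#^n≈1# D)))))
                  (+-congʳ (*-congˡ (*-congˡ (*-cong (1#^n≈1# B) (*-congˡ (1#^n≈1# D)))))) ⟩
      (p * 1#) * (q ^ A * (q ^ B * (q ^ C′ * 1#))) + ((q * 1#) * (q ^ A * (1# * (q ^ C′ * 1#))) + 0#)
        ≈⟨ solve 5 (λ p q QA QB QC → (p :* con 1) :* (QA :* (QB :* (QC :* con 1)))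
                                     :+ ((q :* con 1) :* (QA :* (con 1 :* (QC :* con 1))) :+ con 0)
                                   := QC :* (q :* QA :+ p :* (QA :* QB))) refl p q _ _ _ ⟩
      q ^ C′ * (q ^ suc A + p * (q ^ A * q ^ B))
        ≈⟨ *-congˡ (+-congˡ (*-congˡ (sym (trans (^-congʳ q (countFin-∧-split m T a)) (^-homo-* q A B))))) ⟩
      q ^ C′ * (q ^ suc A + p * q ^ countFin m T) ∎
      where
      A = countFin∧ m T a
      B = countFin∧ m T (not ∘ a)
      C′ = countFin∧ m (not ∘ T) a
      D = countFin∧ m (not ∘ T) (not ∘ a)

    ∑-rootEdge : (T : Fin m → Bool) (k k′ : ℕ) →
      ∑[ a ∶ m ↦ bools ] (rootFactor T true a * (vertexFactor T true true a ^ k * vertexFactor T false true a ^ k′))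
        ≈ (p * (q ^ k * missProb (countFin m T) ^ k′)) * (q ^ countFin m T * missProb k ^ countFin m (not ∘ T))
    ∑-rootEdge T k k′ = begin
      ∑[ a ∶ m ↦ bools ] (rootFactor T true a * (vertexFactor T true true a ^ k * vertexFactor T false true a ^ k′))
        ≈⟨ ∑-cong (allFuns m bools) factor ⟩
      ∑[ a ∶ m ↦ bools ] (κ * ∏[ j < m ] neighbourFactor k (T j) (a j))
        ≈⟨ sym (*-distribˡ-∑ (allFuns m bools) κ _) ⟩
      κ * ∑[ a ∶ m ↦ bools ] ∏[ j < m ] neighbourFactor k (T j) (a j)
        ≈⟨ *-congˡ (∑ᶠ-∏ m bools λ j → neighbourFactor k (T j)) ⟩
      κ * ∏[ j < m ] ∑[ α ∈ bools ] neighbourFactor k (T j) α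
        ≈⟨ *-congˡ (∏-cong m λ j → ∑-neighbourFactor k (T j)) ⟩
      κ * ∏[ j < m ] (if T j then q else missProb k)
        ≈⟨ *-congˡ (∏-count m (λ t → if t then q else missProb k) T) ⟩
      κ * (q ^ countFin m T * missProb k ^ countFin m (not ∘ T)) ∎
      where
      κ : Carrier
      κ = p * (q ^ k * missProb (countFin m T) ^ k′)
      factor : ∀ a → rootFactor T true a * (vertexFactor T true true a ^ k * vertexFactor T false true a ^ k′)
                     ≈ κ * ∏[ j < m ] neighbourFactor k (T j) (a j)
      factor a = begin
        rootFactor T true a * (vertexFactor T true true a ^ k * vertexFactor T false true a ^ k′)
          ≈⟨ *-congˡ (*-cong (trans (^-congˡ k (vertexFactor-marked-at-edge T a))
                                (trans (Exp.^-distrib-* q _ k) (*-congˡ (trans (^-distrib-∏ m k _) (∏-cong m λ j → ^-if k (a j))))))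
                             (^-congˡ k′ (vertexFactor-unmarked T true a))) ⟩
        (p * ∏[ j < m ] (edgeProb (a j) * avoid (T j) (a j)))
          * ((q ^ k * ∏[ j < m ] (if a j then q ^ k else 1#)) * missProb (countFin m T) ^ k′)
          ≈⟨ solve 5 (λ p P₁ Q P₂ B → (p :* P₁) :* ((Q :* P₂) :* B) := (p :* (Q :* B)) :* (P₁ :* P₂)) refl p _ _ _ _ ⟩
        κ * (∏[ j < m ] (edgeProb (a j) * avoid (T j) (a j)) * ∏[ j < m ] (if a j then q ^ k else 1#))
          ≈⟨ *-congˡ (sym (∏-distrib-* m _ _)) ⟩
        κ * ∏[ j < m ] neighbourFactor k (T j) (a j) ∎

    ∑-rootNonEdge : (T : Fin m → Bool) (k k′ : ℕ) →
      ∑[ a ∶ m ↦ bools ] (rootFactor T false a * (vertexFactor T true false a ^ k * vertexFactor T false false a ^ k′))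
        ≈ (q * missProb (countFin m T) ^ k′)
          * (pathSum (countFin m T) (pathWeight k (countFin m T)) * (p * q ^ k + q) ^ countFin m (not ∘ T))
    ∑-rootNonEdge T k k′ = trans (∑-cong (allFuns m bools) factor)
      (trans (sym (*-distribˡ-∑ (allFuns m bools) κ _)) (*-congˡ (∑ᶠ-count-within m T (pathWeight k l) (p * q ^ k) q)))
      where
      l = countFin m T
      κ = q * missProb l ^ k′
      factor : ∀ a → rootFactor T false a * (vertexFactor T true false a ^ k * vertexFactor T false false a ^ k′)
        ≈ κ * (pathWeight k l (countFin∧ m T a) (countFin∧ m T (not ∘ a))
               * ((p * q ^ k) ^ countFin∧ m (not ∘ T) a * q ^ countFin∧ m (not ∘ T) (not ∘ a)))
      factor a = begin
        rootFactor T false a * (vertexFactor T true false a ^ k * vertexFactor T false false a ^ k′)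
          ≈⟨ *-cong (*-congˡ (trans (∏-cong m λ j → trans (*-congˡ (avoid-false (T j))) (*-identityʳ _))
                                   (∏-count₂ m (λ _ α → edgeProb α) T a)))
                    (*-cong (trans (^-congˡ k (vertexFactor-marked-at-nonedge T a))
                                   (trans (Exp.^-distrib-* _ _ k) (*-congʳ qᶜᵏ≈qᵏᶜ)))
                            (^-congˡ k′ (vertexFactor-unmarked T false a))) ⟩
        (q * (p ^ A * (q ^ B * (p ^ C′ * q ^ D)))) * (((q ^ k) ^ C′ * (q ^ suc A + p * q ^ l) ^ k) * missProb l ^ k′)
          ≈⟨ solve 8 (λ q PA QB PC QD QkC Φ M → (q :* (PA :* (QB :* (PC :* QD)))) :* ((QkC :* Φ) :* M)
                                              := (q :* M) :* (((PA :* QB) :* Φ) :* ((PC :* QkC) :* QD))) refl q _ _ _ _ _ _ _ ⟩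
        κ * ((p ^ A * q ^ B * (q ^ suc A + p * q ^ l) ^ k) * ((p ^ C′ * (q ^ k) ^ C′) * q ^ D))
          ≈⟨ *-congˡ (*-congˡ (*-congʳ (sym (Exp.^-distrib-* p (q ^ k) C′)))) ⟩
        κ * (pathWeight k l A B * ((p * q ^ k) ^ C′ * q ^ D)) ∎
        where
        A = countFin∧ m T a
        B = countFin∧ m T (not ∘ a)
        C′ = countFin∧ m (not ∘ T) a
        D = countFin∧ m (not ∘ T) (not ∘ a)
        qᶜᵏ≈qᵏᶜ : (q ^ C′) ^ k ≈ (q ^ k) ^ C′
        qᶜᵏ≈qᵏᶜ = trans (^-assocʳ q C′ k) (trans (^-congʳ q (ℕP.*-comm C′ k)) (sym (^-assocʳ q k C′)))

    avoidanceProb≈formula : (S : Fin n → Bool) (T : Fin m → Bool) →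
      avoidanceProb S T ≈ avoidanceFormula (countFin n S) (countFin n (not ∘ S)) (countFin m T) (countFin m (not ∘ T))
    avoidanceProb≈formula S T = trans (avoidanceProb-factor S T)
      (+-cong (∑-rootEdge T (countFin n S) (countFin n (not ∘ S)))
              (trans (+-identityʳ _) (∑-rootNonEdge T (countFin n S) (countFin n (not ∘ S)))))

    countTerm : ℕ → ℕ → ℕ → ℕ → Carrier
    countTerm k k′ l l′ = (((1# - x) ^ k * x ^ k′) * ((1# - y) ^ l * y ^ l′)) * avoidanceFormula k k′ l l′

    ∑markWeight≈binomialSum :
      ∑[ S ∶ n ↦ bools ] ∑[ T ∶ m ↦ bools ]
          (markWeight S T * avoidanceFormula (countFin n S) (countFin n (not ∘ S)) (countFin m T) (countFin m (not ∘ T)))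
        ≈ ∑[ k < suc n ] ((n C k) × ∑[ l < suc m ] ((m C l) × countTerm k (n ∸ k) l (m ∸ l)))
    ∑markWeight≈binomialSum = begin
      ∑[ S ∶ n ↦ bools ] ∑[ T ∶ m ↦ bools ]
          (markWeight S T * avoidanceFormula (countFin n S) (countFin n (not ∘ S)) (countFin m T) (countFin m (not ∘ T)))
        ≈⟨ ∑-cong (allFuns n bools) (λ S → ∑-cong (allFuns m bools) λ T →
             *-congʳ (*-cong (∏-count n (mark x) S) (∏-count m (mark y) T))) ⟩
      ∑[ S ∶ n ↦ bools ] ∑[ T ∶ m ↦ bools ] countTerm (countFin n S) (countFin n (not ∘ S)) (countFin m T) (countFin m (not ∘ T))
        ≈⟨ ∑-cong (allFuns n bools) (λ S → ∑ᶠ-count≈binomialSum m (countTerm (countFin n S) (countFin n (not ∘ S)))) ⟩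
      ∑[ S ∶ n ↦ bools ] ∑[ l < suc m ] ((m C l) × countTerm (countFin n S) (countFin n (not ∘ S)) l (m ∸ l))
        ≈⟨ ∑ᶠ-count≈binomialSum n (λ k k′ → ∑[ l < suc m ] ((m C l) × countTerm k k′ l (m ∸ l))) ⟩
      ∑[ k < suc n ] ((n C k) × ∑[ l < suc m ] ((m C l) × countTerm k (n ∸ k) l (m ∸ l))) ∎

    countTerm≈rhsSummand : (k l : ℕ) → countTerm k (n ∸ k) l (m ∸ l) ≈
      x ^ (n ∸ k) * (1# - x) ^ k * y ^ (m ∸ l) * (1# - y) ^ l
      * missProb k ^ (m ∸ l) * missProb l ^ (n ∸ k)
      * (q ^ (k ℕ.+ l) * p + q * ∑[ i < suc l ] ((l C i) × pathWeight k l i (l ∸ i)))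
    countTerm≈rhsSummand k l = trans
      (*-congˡ (+-congˡ (*-congˡ (*-cong (pathSum≈binomialSum l (pathWeight k l)) (^-congˡ (m ∸ l) (+-comm (p * q ^ k) q))))))
      (trans (solve 11 (λ X₁ X₂ Y₁ Y₂ A B p q Qk Ql Σ →
                ((X₂ :* X₁) :* (Y₂ :* Y₁)) :* ((p :* (Qk :* B)) :* (Ql :* A) :+ (q :* B) :* (Σ :* A))
                  := X₁ :* X₂ :* Y₁ :* Y₂ :* A :* B :* ((Qk :* Ql) :* p :+ q :* Σ)) refl _ _ _ _ _ _ p q _ _ _)
             (*-congˡ (+-congʳ (*-congʳ (sym (^-homo-* q k l))))))

    binomialSum≈rhsFormula :
      ∑[ k < suc n ] ((n C k) × ∑[ l < suc m ] ((m C l) × countTerm k (n ∸ k) l (m ∸ l))) ≈ rhsFormula R (suc n) (suc m) p x y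
    binomialSum≈rhsFormula = ∑<-cong (suc n) λ k → trans (×-distrib-∑< (n C k) (suc m) _)
      (∑<-cong (suc m) λ l → ×-congʳ (n C k) (×-congʳ (m C l) (countTerm≈rhsSummand k l)))

theorem1 : {c ℓ : Level} (R : CommutativeRing c ℓ) (n m : ℕ)
    (v : Fin (suc n)) (w : Fin (suc m)) (p x y : CommutativeRing.Carrier R) →
    CommutativeRing._≈_ R (jointPGF R (suc n) (suc m) v w p x y) (rhsFormula R (suc n) (suc m) p x y)
theorem1 R n m v w p x y =
  trans (jointPGF≈∑corner v w)
  (trans ∑corner≈∑markWeight
  (trans (∑-cong (allFuns n bools) λ S → ∑-cong (allFuns m bools) λ T → *-congˡ (avoidanceProb≈formula S T))
  (trans ∑markWeight≈binomialSum
         binomialSum≈rhsFormula)))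
  where
  open CommutativeRing R using (trans; *-congˡ)
  open FiniteSums R using (∑-cong)
  open RandomBipartiteGraph R p x y
  open Corner n m
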